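{- Let $n\ge k$ be positive integers, $f_k$ the $k$-clique Boolean function on $n$ vertices, and $X_k$ the set of the $\binom k2$ edge variables among some fixed set of $k$ vertices. If $f_k^{restricted}(X_k)=C_1\vee C_2\vee\dots\vee C_m$ is written in disjunctive normal form, then each clause $C_i$ ($1\le i\le m$) contains all of the variables in $X_k$.
   Context: The $k$-clique function $f_k$ takes as input a graph on vertex set $\{1,\dots,n\}$ encoded by $\binom n2$ bits $e_{ij}$ ($i<j$), $e_{ij}=1$ meaning the edge $\{i,j\}$ is present; $f_k=1$ iff the graph contains a clique on $k$ vertices. For a Boolean function $f$ and a subset $X$ of its variables, $f^{restricted}(X)$ denotes the Boolean function of the variables in $X$ obtained from $f$ by assigning the value $0$ to every variable not in $X$. A disjunctive normal form is a disjunction of clauses, each clause being a conjunction of literals (variables or negated variables). -}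

module Defs where

open import Data.Bool using (Bool; true; false; T; _∧_; not; if_then_else_)
open import Data.Bool.Properties using (T?)
open import Data.Nat using (ℕ)
open import Data.Fin using (Fin; _<_)
open import Data.Fin.Subset using (Subset; ∣_∣)
open import Data.Vec using (lookup)
open import Data.List using (List)
open import Data.Bool.ListAction using (all; any)
open import Data.List.Relation.Unary.Any using (Any)
open import Data.Product using (Σ; _×_; _,_; proj₁; proj₂; ∃)
open import Data.Empty using (⊥)
open import Relation.Nullary using (yes; no)
open import Relation.Binary.PropositionalEquality using (_≡_)

Edge : ℕ → Set
Edge n = Σ (Fin n × Fin n) (λ p → proj₁ p < proj₂ p)

Graph : ℕ → Set
Graph n = Edge n → Bool

HasClique : ∀ {n} → ℕ → Graph n → Set
HasClique {n} k e =
  ∃ λ (s : Subset n) → ∣ s ∣ ≡ k ×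
    (∀ (i j : Fin n) (lt : i < j) → T (lookup s i) → T (lookup s j) → e ((i , j) , lt) ≡ true)

inXb : ∀ {n} → Subset n → Edge n → Bool
inXb S ((i , j) , _) = lookup S i ∧ lookup S j

XVar : ∀ {n} → Subset n → Set
XVar {n} S = Σ (Edge n) (λ e → T (inXb S e))

extend : ∀ {n} (S : Subset n) → (XVar S → Bool) → Graph n
extend S ρ e with T? (inXb S e)
... | yes q = ρ (e , q)
... | no _  = false

-- Disjunctive normal forms over a variable type V.
-- A literal is a variable with a polarity (true = positive, false = negated).
Literal : Set → Set
Literal V = V × Bool

Clause : Set → Set
Clause V = List (Literal V)

DNF : Set → Set
DNF V = List (Clause V)

evalLit : ∀ {V} → (V → Bool) → Literal V → Bool
evalLit ρ (x , b) = if b then ρ x else not (ρ x)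

evalClause : ∀ {V} → (V → Bool) → Clause V → Bool
evalClause ρ C = all (evalLit ρ) C

evalDNF : ∀ {V} → (V → Bool) → DNF V → Bool
evalDNF ρ D = any (evalClause ρ) D

RepresentsRestrictedClique : ∀ {n} (k : ℕ) (S : Subset n) → DNF (XVar S) → Set
RepresentsRestrictedClique k S D =
  ∀ (ρ : XVar S → Bool) → (evalDNF ρ D ≡ true → HasClique k (extend S ρ))
                         × (HasClique k (extend S ρ) → evalDNF ρ D ≡ true)

ContainsVar : ∀ {V} → Clause V → V → Set
ContainsVar C x = Any (λ l → proj₁ l ≡ x) C

Consistent : ∀ {V} → Clause V → Set
Consistent C = ∀ x → Any (λ l → l ≡ (x , true)) C → Any (λ l → l ≡ (x , false)) C → ⊥

{-# OPTIONS --safe #-}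
-- Suppose a clause C of the DNF does not mention the variable x of X_S. Satisfy C with
-- the assignment that gives each literal of C its polarity and sets every other variable,
-- x among them, to 0. The DNF is then true, so the graph has a k-clique; but its edges all
-- lie inside S, which has exactly k vertices, so the clique must be S itself and every
-- edge of X_S, x included, must be present.
module Submission where

open import Defs
open import Data.Bool using (Bool; true; false; T; not; _∧_)
open import Data.Bool.Properties using (T?; T-≡; T-∧; T-irrelevant)
open import Data.Nat using (ℕ; suc; _≤_)
import Data.Nat.Properties as ℕ
open import Data.Fin using (Fin; _<_)
open import Data.Fin.Properties using (_≟_; <-cmp; <-irrelevant; <⇒≢)
open import Data.Fin.Subset using (Subset; ∣_∣; _⊆_; ⁅_⁆) renaming (_∈_ to _∈ₛ_; _∉_ to _∉ₛ_)
open import Data.Fin.Subset.Properties using (_∈?_; x∈⁅x⁆; x∈⁅y⁆⇒x≡y; ∣⁅x⁆∣≡1; p⊆q⇒∣p∣≤∣q∣; p⊂q⇒∣p∣<∣q∣)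
open import Data.Vec using (lookup)
open import Data.Vec.Properties using ([]=⇒lookup; lookup⇒[]=)
open import Data.List using ([]; _∷_)
open import Data.List.Membership.Propositional using (_∈_; lose)
open import Data.List.Relation.Unary.All using (tabulate)
open import Data.List.Relation.Unary.All.Properties using (all⁻)
open import Data.List.Relation.Unary.Any using (here; there; tail; any?) renaming (map to mapAny)
open import Data.List.Relation.Unary.Any.Properties using (any⁺)
open import Data.Product using (_×_; _,_; proj₁; proj₂)
open import Data.Product.Properties using (≡-dec)
open import Function using (_∘_)
open import Function.Bundles using (Equivalence)
open import Relation.Binary using (tri<; tri≈; tri>)
open import Relation.Binary.Definitions using (DecidableEquality)
open import Relation.Binary.PropositionalEquality using (_≡_; _≢_; refl; sym; cong; subst; module ≡-Reasoning)
open import Relation.Nullary using (¬_; yes; no; contradiction)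
open import Relation.Nullary.Decidable using (decidable-stable)

open Equivalence using (to; from)

T-lookup⇒∈ : ∀ {n} {p : Subset n} {x : Fin n} → T (lookup p x) → x ∈ₛ p
T-lookup⇒∈ {p = p} {x} t = lookup⇒[]= x p (to T-≡ t)

∈⇒T-lookup : ∀ {n} {p : Subset n} {x : Fin n} → x ∈ₛ p → T (lookup p x)
∈⇒T-lookup x∈p = from T-≡ ([]=⇒lookup x∈p)

module _ {n : ℕ} where

  p⊆⁅x⁆⇒∣p∣≤1 : {p : Subset n} {x : Fin n} → p ⊆ ⁅ x ⁆ → ∣ p ∣ ≤ 1
  p⊆⁅x⁆⇒∣p∣≤1 {x = x} p⊆⁅x⁆ = subst (_ ≤_) (∣⁅x⁆∣≡1 x) (p⊆q⇒∣p∣≤∣q∣ p⊆⁅x⁆)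

  x∈p∧y∈p∧x≢y⇒2≤∣p∣ : {p : Subset n} {x y : Fin n} → x ∈ₛ p → y ∈ₛ p → x ≢ y → 2 ≤ ∣ p ∣
  x∈p∧y∈p∧x≢y⇒2≤∣p∣ {p} {x} {y} x∈p y∈p x≢y =
    subst (λ m → suc m ≤ ∣ p ∣) (∣⁅x⁆∣≡1 x) (p⊂q⇒∣p∣<∣q∣ (⁅x⁆⊆p , y , y∈p , y∉⁅x⁆))
    where
    ⁅x⁆⊆p : ⁅ x ⁆ ⊆ p
    ⁅x⁆⊆p z∈⁅x⁆ = subst (_∈ₛ p) (sym (x∈⁅y⁆⇒x≡y x z∈⁅x⁆)) x∈p

    y∉⁅x⁆ : y ∉ₛ ⁅ x ⁆
    y∉⁅x⁆ y∈⁅x⁆ = x≢y (sym (x∈⁅y⁆⇒x≡y x y∈⁅x⁆))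

  p⊆q∧∣p∣≡∣q∣⇒q⊆p : {p q : Subset n} → p ⊆ q → ∣ p ∣ ≡ ∣ q ∣ → q ⊆ p
  p⊆q∧∣p∣≡∣q∣⇒q⊆p {p} p⊆q ∣p∣≡∣q∣ {x} x∈q with x ∈? p
  ... | yes x∈p = x∈p
  ... | no  x∉p = contradiction (p⊂q⇒∣p∣<∣q∣ (p⊆q , x , x∈q , x∉p)) (ℕ.<-irrefl ∣p∣≡∣q∣)

T-∧-lookup⇒∈ : ∀ {n} (S : Subset n) (i j : Fin n) → T (lookup S i ∧ lookup S j) → i ∈ₛ S × j ∈ₛ S
T-∧-lookup⇒∈ S i j i∈S∧j∈S with to T-∧ i∈S∧j∈S
... | i∈S , j∈S = T-lookup⇒∈ i∈S , T-lookup⇒∈ j∈S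

module _ {n : ℕ} where

  SupportedOn : Subset n → Graph n → Set
  SupportedOn S e = ∀ i j (i<j : i < j) → e ((i , j) , i<j) ≡ true → i ∈ₛ S × j ∈ₛ S

  IsClique : Graph n → Subset n → Set
  IsClique e s = ∀ i j (i<j : i < j) → i ∈ₛ s → j ∈ₛ s → e ((i , j) , i<j) ≡ true

  module _ {S : Subset n} {e : Graph n} (supported : SupportedOn S e) where

    clique-neighbour∈support : ∀ {s u w} → IsClique e s → u ∈ₛ s → w ∈ₛ s → w ≢ u → u ∈ₛ S
    clique-neighbour∈support {u = u} {w} clique u∈s w∈s w≢u with <-cmp w u
    ... | tri< w<u _   _   = proj₂ (supported w u w<u (clique w u w<u w∈s u∈s))
    ... | tri≈ _   w≡u _   = contradiction w≡u w≢u
    ... | tri> _   _   u<w = proj₁ (supported u w u<w (clique u w u<w u∈s w∈s))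

    clique⊆support : ∀ {s} → IsClique e s → 2 ≤ ∣ s ∣ → s ⊆ S
    clique⊆support {s} clique 2≤∣s∣ {u} u∈s with u ∈? S
    ... | yes u∈S = u∈S
    ... | no  u∉S = contradiction (p⊆⁅x⁆⇒∣p∣≤1 s⊆⁅u⁆) (ℕ.<⇒≱ 2≤∣s∣)
      where
      s⊆⁅u⁆ : s ⊆ ⁅ u ⁆
      s⊆⁅u⁆ {w} w∈s with w ≟ u
      ... | yes refl = x∈⁅x⁆ u
      ... | no  w≢u  = contradiction (clique-neighbour∈support clique u∈s w∈s w≢u) u∉S

    -- x gives S, hence the clique, two vertices; so the clique lies in S and, by size, is S.
    clique-of-size-∣S∣⇒complete-on-X : HasClique ∣ S ∣ e → (x : XVar S) → e (proj₁ x) ≡ true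
    clique-of-size-∣S∣⇒complete-on-X (s , ∣s∣≡∣S∣ , cl) (((i , j) , i<j) , x∈X)
      with T-∧-lookup⇒∈ S i j x∈X
    ... | i∈S , j∈S = clique i j i<j (S⊆s i∈S) (S⊆s j∈S)
      where
      clique : IsClique e s
      clique i j i<j i∈s j∈s = cl i j i<j (∈⇒T-lookup i∈s) (∈⇒T-lookup j∈s)

      2≤∣s∣ : 2 ≤ ∣ s ∣
      2≤∣s∣ = subst (2 ≤_) (sym ∣s∣≡∣S∣) (x∈p∧y∈p∧x≢y⇒2≤∣p∣ i∈S j∈S (<⇒≢ i<j))

      S⊆s : S ⊆ s
      S⊆s = p⊆q∧∣p∣≡∣q∣⇒q⊆p (clique⊆support clique 2≤∣s∣) ∣s∣≡∣S∣

module _ {n : ℕ} (S : Subset n) where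

  XVar-≟ : DecidableEquality (XVar S)
  XVar-≟ = ≡-dec (≡-dec (≡-dec _≟_ _≟_) (λ p q → yes (<-irrelevant p q)))
                 (λ p q → yes (T-irrelevant p q))

  extend-supported : (ρ : XVar S → Bool) → SupportedOn S (extend S ρ)
  extend-supported ρ i j i<j _ with T? (inXb S ((i , j) , i<j))
  ... | yes x∈X = T-∧-lookup⇒∈ S i j x∈X
  extend-supported ρ i j i<j () | no _

  extend-on-X : (ρ : XVar S → Bool) (x : XVar S) → extend S ρ (proj₁ x) ≡ ρ x
  extend-on-X ρ (e , x∈X) with T? (inXb S e)
  ... | yes x∈X′ = cong (λ q → ρ (e , q)) (T-irrelevant x∈X′ x∈X)
  ... | no  x∉X  = contradiction x∈X x∉X

module _ {V : Set} where

  consistent-polarity : ∀ {C : Clause V} {y b b′} →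
                        Consistent C → (y , b) ∈ C → (y , b′) ∈ C → b ≡ b′
  consistent-polarity {b = true}  {true}  _ _ _ = refl
  consistent-polarity {b = false} {false} _ _ _ = refl
  consistent-polarity {y = y} {true}  {false} consistent p q =
    contradiction (mapAny sym q) (consistent y (mapAny sym p))
  consistent-polarity {y = y} {false} {true}  consistent p q =
    contradiction (mapAny sym p) (consistent y (mapAny sym q))

  evalLit-≡ : ∀ {ρ : V → Bool} {y b} → ρ y ≡ b → evalLit ρ (y , b) ≡ true
  evalLit-≡ {b = true}  ρy≡true  = ρy≡true
  evalLit-≡ {b = false} ρy≡false = cong not ρy≡false

  evalDNF-∈ : ∀ {ρ : V → Bool} {C D} → C ∈ D → evalClause ρ C ≡ true → evalDNF ρ D ≡ true
  evalDNF-∈ {ρ} C∈D C-true = to T-≡ (any⁺ (evalClause ρ) (lose C∈D (from T-≡ C-true)))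

  module _ (_≟ᵥ_ : DecidableEquality V) where

    clauseAssignment : Clause V → V → Bool
    clauseAssignment []            y = false
    clauseAssignment ((x , b) ∷ C) y with x ≟ᵥ y
    ... | yes _ = b
    ... | no  _ = clauseAssignment C y

    clauseAssignment-∉ : ∀ C {y} → ¬ ContainsVar C y → clauseAssignment C y ≡ false
    clauseAssignment-∉ []            _   = refl
    clauseAssignment-∉ ((x , b) ∷ C) {y} C∌y with x ≟ᵥ y
    ... | yes x≡y = contradiction (here x≡y) C∌y
    ... | no  _   = clauseAssignment-∉ C (C∌y ∘ there)

    clauseAssignment-∈ : ∀ {C y b} → Consistent C → (y , b) ∈ C → clauseAssignment C y ≡ b
    clauseAssignment-∈ {(x , b′) ∷ C} {y} consistent y∈C with x ≟ᵥ y
    ... | yes refl = consistent-polarity consistent (here refl) y∈C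
    ... | no  x≢y  = clauseAssignment-∈ consistent-C (tail (x≢y ∘ sym ∘ cong proj₁) y∈C)
      where
      consistent-C : Consistent C
      consistent-C z p q = consistent z (there p) (there q)

    clauseAssignment-satisfies : ∀ {C} → Consistent C → evalClause (clauseAssignment C) C ≡ true
    clauseAssignment-satisfies {C} consistent =
      to T-≡ (all⁻ (evalLit ρ) (tabulate λ {(y , b)} y∈C →
        from T-≡ (evalLit-≡ {ρ = ρ} (clauseAssignment-∈ consistent y∈C))))
      where
      ρ : V → Bool
      ρ = clauseAssignment C

theorem2 : (n k : ℕ) → 1 ≤ k → k ≤ n → (S : Subset n) → ∣ S ∣ ≡ k →
    (D : DNF (XVar S)) → RepresentsRestrictedClique k S D →
    (C : Clause (XVar S)) → C ∈ D → Consistent C →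
    (x : XVar S) → ContainsVar C x
theorem2 n k _ _ S ∣S∣≡k D represents C C∈D consistent x =
  decidable-stable (any? (λ l → XVar-≟ S (proj₁ l) x) C) λ C∌x →
    contradiction (x-present C∌x) λ ()
  where
  ρ : XVar S → Bool
  ρ = clauseAssignment (XVar-≟ S) C

  clique : HasClique ∣ S ∣ (extend S ρ)
  clique = subst (λ m → HasClique m (extend S ρ)) (sym ∣S∣≡k)
    (proj₁ (represents ρ) (evalDNF-∈ C∈D (clauseAssignment-satisfies (XVar-≟ S) consistent)))

  x-present : ¬ ContainsVar C x → true ≡ false
  x-present C∌x = begin
    true                 ≡⟨ sym (clique-of-size-∣S∣⇒complete-on-X (extend-supported S ρ) clique x) ⟩
    extend S ρ (proj₁ x) ≡⟨ extend-on-X S ρ x ⟩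
    ρ x                  ≡⟨ clauseAssignment-∉ (XVar-≟ S) C C∌x ⟩
    false                ∎
    where open ≡-Reasoning
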